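{- Every point $(d_1,d_3)\in S_{13}$ satisfies $d_1\le 3d_3+3/8$.
   Context: For graphs $H$ (on $k$ vertices) and $G$, the density $d(H,G)$ is the probability that $k$ uniformly random distinct vertices of $G$ induce a subgraph isomorphic to $H$. For $k=0,1,2,3$ let $H_k$ be the $3$-vertex graph with exactly $k$ edges (so $H_1$ is the co-cherry and $H_3$ the triangle). Let $S\subseteq\mathbb{R}^4$ be the set of all $(d_0,d_1,d_2,d_3)$ such that there is a sequence of graphs $(G_n)$ whose numbers of vertices tend to infinity and with $d(H_k,G_n)\to d_k$ for $k=0,1,2,3$. Let $S_{13}=\{(d_1,d_3): (d_0,d_1,d_2,d_3)\in S \text{ for some } d_0,d_2\}$. -}

module Defs where

open import Data.Nat as ℕ using (ℕ; zero; suc; _<ᵇ_; _≡ᵇ_)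
open import Data.Nat.Combinatorics using (_C_)
open import Data.Bool using (Bool; true; false; if_then_else_; _∧_)
open import Data.Fin using (Fin; toℕ)
open import Data.List using (List; map; concatMap; allFin)
open import Data.Nat.ListAction using (sum)
open import Data.Integer using (+_)
open import Data.Rational using (ℚ; 0ℚ; _/_; _+_; _*_; _-_; ∣_∣; _≤_; _<_)
open import Data.Product using (∃; _×_)
open import Relation.Binary.PropositionalEquality using (_≡_)

record Graph : Set where
  field
    size   : ℕ
    adj    : Fin size → Fin size → Bool
    sym    : ∀ i j → adj i j ≡ adj j i
    irrefl : ∀ i → adj i i ≡ false
open Graph public

b2n : Bool → ℕ
b2n true  = 1
b2n false = 0

edgesAmong : (G : Graph) → Fin (size G) → Fin (size G) → Fin (size G) → ℕ
edgesAmong G i j k = b2n (adj G i j) ℕ.+ b2n (adj G i k) ℕ.+ b2n (adj G j k)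

-- number of 3-subsets {i<j<k} of V(G) inducing a graph with exactly e edges,
-- i.e. inducing a copy of H_e (a 3-vertex graph is determined up to iso by its edge count)
inducedCount : (e : ℕ) → Graph → ℕ
inducedCount e G =
  sum (concatMap (λ i → concatMap (λ j → map (λ k →
        b2n ((toℕ i <ᵇ toℕ j) ∧ (toℕ j <ᵇ toℕ k) ∧ (edgesAmong G i j k ≡ᵇ e)))
      (allFin (size G))) (allFin (size G))) (allFin (size G)))

-- c / m as a rational (convention 0 when m = 0, i.e. fewer than 3 vertices)
ratio : ℕ → ℕ → ℚ
ratio c zero    = 0ℚ
ratio c (suc m) = (+ c) / suc m

d : (e : ℕ) → Graph → ℚ
d e G = ratio (inducedCount e G) (size G C 3)

SizeToInfinity : (ℕ → Graph) → Set
SizeToInfinity Gs = ∀ N → ∃ λ M → ∀ m → M ℕ.≤ m → N ℕ.≤ size (Gs m)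

-- a rational sequence converges (to a real number), i.e. it is Cauchy
Converges : (ℕ → ℚ) → Set
Converges a = ∀ (ε : ℚ) → 0ℚ < ε →
  ∃ λ M → ∀ m m' → M ℕ.≤ m → M ℕ.≤ m' → ∣ a m - a m' ∣ < ε

-- lim a ≤ lim b + c (for convergent a, b): eventually a m ≤ b m + c + ε, for every ε > 0
LimLe : (ℕ → ℚ) → (ℕ → ℚ) → ℚ → Set
LimLe a b c = ∀ (ε : ℚ) → 0ℚ < ε →
  ∃ λ M → ∀ m → M ℕ.≤ m → a m ≤ b m + c + ε

-- For a vertex a of degree D in an n-vertex graph, the weight A(a,b)(1 − 2A(a,c)) summed over b and c
-- is D(n − 2D) ≤ n²/8, so its sum W over all ordered triples (a, b, c) is at most n³/8.  Summed over the
-- six orderings of a triple, the weight is 2 on a co-cherry (one edge), −6 on a triangle and 0 on every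
-- other triple, so W = 2c₁ − 6c₃ for the numbers c₁, c₃ of induced co-cherries and triangles, that is
-- 16c₁ ≤ n³ + 48c₃.  Dividing by C(n,3) = n(n−1)(n−2)/6 gives d₁ ≤ 3d₃ + (3/8)·n³/(n(n−1)(n−2)), and
-- the last factor tends to 1.

module Submission where

open import Data.Bool using (Bool; true; false; _∧_)
open import Data.Fin as Fin using (Fin; toℕ)
import Data.Fin.Properties as Finₚ
open import Data.List using (List; []; _∷_; map; concatMap; tabulate; allFin)
open import Data.Nat as ℕ using (ℕ; zero; suc; _<ᵇ_; _≡ᵇ_; _≟_)
import Data.Nat.Properties as ℕₚ
open import Data.Nat.ListAction using () renaming (sum to sumℕ)
open import Data.Nat.ListAction.Properties using () renaming (sum-++ to sumℕ-++)
open import Data.Product using (_,_; ∃)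
open import Data.Sum using (_⊎_; inj₁; inj₂)
open import Function using (_∘_; id)
open import Relation.Binary.Definitions using (tri<; tri≈; tri>)
open import Relation.Binary.PropositionalEquality
  using (_≡_; _≢_; refl; sym; trans; cong; cong₂; module ≡-Reasoning)
open import Relation.Nullary using (yes; no)
open import Relation.Nullary.Decidable using (dec-true; dec-false)
open import Relation.Nullary.Negation using (contradiction)

open import Defs renaming (sym to adj-sym; irrefl to adj-irrefl)

module _ where
  open import Data.Integer
    using (ℤ; +_; +[1+_]; -[1+_]; nonNegative; 0ℤ; 1ℤ; -1ℤ; _+_; _-_; -_; _*_; _≤_; +≤+)
  import Data.Integer.Properties as ℤ
  open import Data.Integer.Tactic.RingSolver using (solve-∀)
  open import Algebra.Properties.CommutativeSemigroup ℕₚ.+-commutativeSemigroup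
    using (xy∙z≈xz∙y; xy∙z≈yx∙z)
  open import Algebra.Properties.CommutativeSemigroup ℤ.*-commutativeSemigroup using (x∙yz≈y∙xz)
  open import Algebra.Properties.Semiring.Sum ℤ.+-*-semiring
    using (sum; sum-syntax; sum-cong-≗; ∑-comm; ∑-distrib-+; *-distribˡ-sum; *-distribʳ-sum)

  ⟦_⟧ : Bool → ℤ
  ⟦ b ⟧ = + b2n b

  ⟦∧⟧ : ∀ x y → ⟦ x ∧ y ⟧ ≡ ⟦ x ⟧ * ⟦ y ⟧
  ⟦∧⟧ false y = refl
  ⟦∧⟧ true  y = sym (ℤ.*-identityˡ ⟦ y ⟧)

  ⟦∧∧⟧ : ∀ x y z → ⟦ x ∧ y ∧ z ⟧ ≡ ⟦ x ∧ y ⟧ * ⟦ z ⟧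
  ⟦∧∧⟧ false y z = refl
  ⟦∧∧⟧ true  y z = ⟦∧⟧ y z

  y≡0⇒x*y≡y : ∀ x {y} → y ≡ 0ℤ → x * y ≡ y
  y≡0⇒x*y≡y x refl = ℤ.*-zeroʳ x

  0≤i*i : ∀ i → 0ℤ ≤ i * i
  0≤i*i (+ zero) = +≤+ ℕ.z≤n
  0≤i*i +[1+ n ] = +≤+ ℕ.z≤n
  0≤i*i -[1+ n ] = +≤+ ℕ.z≤n

  8i[j-2i]≤j*j : ∀ i j → + 8 * (i * (j - + 2 * i)) ≤ j * j
  8i[j-2i]≤j*j i j = begin
      + 8 * (i * (j - + 2 * i))
    ≤⟨ ℤ.i≤i+j _ ((j - + 4 * i) * (j - + 4 * i)) {{nonNegative (0≤i*i (j - + 4 * i))}} ⟩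
      + 8 * (i * (j - + 2 * i)) + (j - + 4 * i) * (j - + 4 * i)
    ≡⟨ complete-square i j ⟩
      j * j
    ∎
    where
    open ℤ.≤-Reasoning
    complete-square : ∀ i j → + 8 * (i * (j - + 2 * i)) + (j - + 4 * i) * (j - + 4 * i) ≡ j * j
    complete-square = solve-∀

  ∑-const : ∀ n x → ∑[ i < n ] x ≡ + n * x
  ∑-const zero    x = refl
  ∑-const (suc n) x = trans (cong (_+_ x) (∑-const n x)) (sym (ℤ.suc-* (+ n) x))

  ∑-neg : ∀ {n} (f : Fin n → ℤ) → ∑[ i < n ] (- f i) ≡ - sum f
  ∑-neg f = trans (sum-cong-≗ λ i → sym (ℤ.-1*i≡-i (f i)))
                  (trans (sym (*-distribˡ-sum -1ℤ f)) (ℤ.-1*i≡-i (sum f)))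

  ∑[1-2f]≡n-2∑f : ∀ {n} (f : Fin n → ℤ) → ∑[ i < n ] (1ℤ - + 2 * f i) ≡ + n - + 2 * sum f
  ∑[1-2f]≡n-2∑f {n} f = begin
      ∑[ i < n ] (1ℤ - + 2 * f i)
    ≡⟨ ∑-distrib-+ (λ _ → 1ℤ) (λ i → - (+ 2 * f i)) ⟩
      ∑[ i < n ] 1ℤ + ∑[ i < n ] (- (+ 2 * f i))
    ≡⟨ cong₂ _+_ (trans (∑-const n 1ℤ) (ℤ.*-identityʳ (+ n))) (∑-neg (λ i → + 2 * f i)) ⟩
      + n - ∑[ i < n ] (+ 2 * f i)
    ≡⟨ cong (λ x → + n - x) (*-distribˡ-sum (+ 2) f) ⟨
      + n - + 2 * sum f
    ∎
    where open ≡-Reasoning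

  ∑-mono-≤ : ∀ {n} {f g : Fin n → ℤ} → (∀ i → f i ≤ g i) → sum f ≤ sum g
  ∑-mono-≤ {zero}  f≤g = ℤ.≤-refl
  ∑-mono-≤ {suc n} f≤g = ℤ.+-mono-≤ (f≤g Fin.zero) (∑-mono-≤ (f≤g ∘ Fin.suc))

  +sumℕ-map : ∀ {A : Set} {n} (g : Fin n → A) (f : A → ℕ) →
              + sumℕ (map f (tabulate g)) ≡ ∑[ i < n ] (+ f (g i))
  +sumℕ-map {n = zero}  g f = refl
  +sumℕ-map {n = suc n} g f = cong (_+_ (+ f (g Fin.zero))) (+sumℕ-map (g ∘ Fin.suc) f)

  +sumℕ-concatMap : ∀ {A : Set} {n} (g : Fin n → A) (f : A → List ℕ) →
                    + sumℕ (concatMap f (tabulate g)) ≡ ∑[ i < n ] (+ sumℕ (f (g i)))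
  +sumℕ-concatMap {n = zero}  g f = refl
  +sumℕ-concatMap {n = suc n} g f = trans (cong +_ (sumℕ-++ (f (g Fin.zero)) _))
    (cong (_+_ (+ sumℕ (f (g Fin.zero)))) (+sumℕ-concatMap (g ∘ Fin.suc) f))

  -- Sums over ordered triples

  ∑³ : ∀ {n} → (Fin n → Fin n → Fin n → ℤ) → ℤ
  ∑³ {n} F = ∑[ a < n ] ∑[ b < n ] ∑[ c < n ] F a b c

  module _ {n : ℕ} where
    private
      ∑² : (Fin n → Fin n → Fin n → ℤ) → Fin n → Fin n → ℤ
      ∑² F a b = sum (F a b)

    ∑³-cong : {F G : Fin n → Fin n → Fin n → ℤ} → (∀ a b c → F a b c ≡ G a b c) → ∑³ F ≡ ∑³ G
    ∑³-cong F≡G = sum-cong-≗ λ a → sum-cong-≗ λ b → sum-cong-≗ λ c → F≡G a b c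

    ∑³-distrib-+ : (F G : Fin n → Fin n → Fin n → ℤ) →
                   ∑³ (λ a b c → F a b c + G a b c) ≡ ∑³ F + ∑³ G
    ∑³-distrib-+ F G = trans (sum-cong-≗ λ a → trans (sum-cong-≗ λ b → ∑-distrib-+ (F a b) (G a b))
                                                      (∑-distrib-+ (∑² F a) (∑² G a)))
                             (∑-distrib-+ (sum ∘ ∑² F) (sum ∘ ∑² G))

    *-distribˡ-∑³ : ∀ x (F : Fin n → Fin n → Fin n → ℤ) → x * ∑³ F ≡ ∑³ (λ a b c → x * F a b c)
    *-distribˡ-∑³ x F = trans (*-distribˡ-sum x (sum ∘ ∑² F)) (sum-cong-≗ λ a →
                          trans (*-distribˡ-sum x (∑² F a)) (sum-cong-≗ λ b → *-distribˡ-sum x (F a b)))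

    ∑³-swap₁₂ : (F : Fin n → Fin n → Fin n → ℤ) → ∑³ (λ a b c → F b a c) ≡ ∑³ F
    ∑³-swap₁₂ F = ∑-comm λ a b → ∑[ c < n ] F b a c

    ∑³-swap₂₃ : (F : Fin n → Fin n → Fin n → ℤ) → ∑³ (λ a b c → F a c b) ≡ ∑³ F
    ∑³-swap₂₃ F = sum-cong-≗ λ a → ∑-comm λ b c → F a c b

  orderings : {A : Set} → (A → A → A → ℤ) → A → A → A → ℤ
  orderings F a b c = F a b c + F a c b + F b a c + F b c a + F c a b + F c b a

  orderings-swap₁₂ : {A : Set} (F : A → A → A → ℤ) → ∀ a b c → orderings F b a c ≡ orderings F a b c
  orderings-swap₁₂ F a b c = reorder (F a b c) (F a c b) (F b a c) (F b c a) (F c a b) (F c b a)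
    where
    reorder : ∀ x₁ x₂ x₃ x₄ x₅ x₆ → x₃ + x₄ + x₁ + x₂ + x₆ + x₅ ≡ x₁ + x₂ + x₃ + x₄ + x₅ + x₆
    reorder = solve-∀

  orderings-swap₂₃ : {A : Set} (F : A → A → A → ℤ) → ∀ a b c → orderings F a c b ≡ orderings F a b c
  orderings-swap₂₃ F a b c = reorder (F a b c) (F a c b) (F b a c) (F b c a) (F c a b) (F c b a)
    where
    reorder : ∀ x₁ x₂ x₃ x₄ x₅ x₆ → x₂ + x₁ + x₅ + x₆ + x₃ + x₄ ≡ x₁ + x₂ + x₃ + x₄ + x₅ + x₆
    reorder = solve-∀

  ∑³-orderings : ∀ {n} (F : Fin n → Fin n → Fin n → ℤ) → ∑³ (orderings F) ≡ + 6 * ∑³ F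
  ∑³-orderings {n} F = begin
      ∑³ (orderings F)
    ≡⟨ distrib ⟩
      ∑³ F + ∑³ acb + ∑³ bac + ∑³ bca + ∑³ cab + ∑³ cba
    ≡⟨ cong₂ _+_ (cong₂ _+_ (cong₂ _+_ (cong₂ _+_ (cong (_+_ (∑³ F)) acb≡) bac≡) bca≡) cab≡) cba≡ ⟩
      ∑³ F + ∑³ F + ∑³ F + ∑³ F + ∑³ F + ∑³ F
    ≡⟨ six (∑³ F) ⟩
      + 6 * ∑³ F
    ∎
    where
    open ≡-Reasoning
    acb bac bca cab cba : Fin n → Fin n → Fin n → ℤ
    acb a b c = F a c b
    bac a b c = F b a c
    bca a b c = F b c a
    cab a b c = F c a b
    cba a b c = F c b a

    distrib : ∑³ (orderings F) ≡ ∑³ F + ∑³ acb + ∑³ bac + ∑³ bca + ∑³ cab + ∑³ cba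
    distrib = trans (∑³-distrib-+ _ cba) (cong (_+ ∑³ cba)
             (trans (∑³-distrib-+ _ cab) (cong (_+ ∑³ cab)
             (trans (∑³-distrib-+ _ bca) (cong (_+ ∑³ bca)
             (trans (∑³-distrib-+ _ bac) (cong (_+ ∑³ bac)
                    (∑³-distrib-+ F acb))))))))

    acb≡ : ∑³ acb ≡ ∑³ F
    acb≡ = ∑³-swap₂₃ F
    bac≡ : ∑³ bac ≡ ∑³ F
    bac≡ = ∑³-swap₁₂ F
    bca≡ : ∑³ bca ≡ ∑³ F
    bca≡ = trans (∑³-swap₁₂ acb) acb≡
    cab≡ : ∑³ cab ≡ ∑³ F
    cab≡ = trans (∑³-swap₂₃ bac) bac≡
    cba≡ : ∑³ cba ≡ ∑³ F
    cba≡ = trans (∑³-swap₂₃ bca) bca≡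

    six : ∀ x → x + x + x + x + x + x ≡ + 6 * x
    six = solve-∀

  record Symmetric₃ {A : Set} (H : A → A → A → ℤ) : Set where
    field
      swap₁₂ : ∀ a b c → H b a c ≡ H a b c
      swap₂₃ : ∀ a b c → H a c b ≡ H a b c

    rotate : ∀ a b c → H b c a ≡ H a b c
    rotate a b c = trans (swap₂₃ b a c) (swap₁₂ a b c)

    rotate⁻¹ : ∀ a b c → H c a b ≡ H a b c
    rotate⁻¹ a b c = trans (swap₁₂ a c b) (swap₂₃ a b c)

    swap₁₃ : ∀ a b c → H c b a ≡ H a b c
    swap₁₃ a b c = trans (swap₁₂ b c a) (rotate a b c)

  orderings-*ʳ : {A : Set} (F H : A → A → A → ℤ) → Symmetric₃ H → ∀ a b c →
                 orderings (λ a b c → F a b c * H a b c) a b c ≡ orderings F a b c * H a b c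
  orderings-*ʳ F H symmetric a b c = begin
      orderings (λ a b c → F a b c * H a b c) a b c
    ≡⟨ cong₂ _+_ (cong₂ _+_ (cong₂ _+_ (cong₂ _+_ (cong (_+_ (F a b c * h))
                                                        (cong (F a c b *_) (swap₂₃ a b c)))
                                                  (cong (F b a c *_) (swap₁₂ a b c)))
                                       (cong (F b c a *_) (rotate a b c)))
                            (cong (F c a b *_) (rotate⁻¹ a b c)))
                 (cong (F c b a *_) (swap₁₃ a b c)) ⟩
      F a b c * h + F a c b * h + F b a c * h + F b c a * h + F c a b * h + F c b a * h
    ≡⟨ factor (F a b c) (F a c b) (F b a c) (F b c a) (F c a b) (F c b a) h ⟩
      orderings F a b c * h
    ∎
    where
    open ≡-Reasoning
    open Symmetric₃ symmetric
    h : ℤ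
    h = H a b c
    factor : ∀ x₁ x₂ x₃ x₄ x₅ x₆ y →
             x₁ * y + x₂ * y + x₃ * y + x₄ * y + x₅ * y + x₆ * y ≡ (x₁ + x₂ + x₃ + x₄ + x₅ + x₆) * y
    factor = solve-∀

  increasing : ∀ {n} → Fin n → Fin n → Fin n → ℤ
  increasing a b c = ⟦ (toℕ a <ᵇ toℕ b) ∧ (toℕ b <ᵇ toℕ c) ⟧

  private
    <ᵇ-true : ∀ {p q} → p ℕ.< q → (p <ᵇ q) ≡ true
    <ᵇ-true {p} {q} p<q = dec-true (p ℕ.<? q) p<q

    <ᵇ-false : ∀ {p q} → q ℕ.≤ p → (p <ᵇ q) ≡ false
    <ᵇ-false {p} {q} q≤p = dec-false (p ℕ.<? q) (ℕₚ.≤⇒≯ q≤p)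

  module _ {n : ℕ} where
    orderings-increasing-sorted : ∀ {a b c : Fin n} → a Fin.< b → b Fin.< c →
                                  orderings increasing a b c ≡ 1ℤ
    orderings-increasing-sorted a<b b<c
      rewrite <ᵇ-true a<b | <ᵇ-true b<c | <ᵇ-true (ℕₚ.<-trans a<b b<c)
            | <ᵇ-false (ℕₚ.<⇒≤ a<b) | <ᵇ-false (ℕₚ.<⇒≤ b<c) | <ᵇ-false (ℕₚ.<⇒≤ (ℕₚ.<-trans a<b b<c))
      = refl

    private
      orderings-increasing-< : ∀ {a b c : Fin n} → a Fin.< b → b ≢ c → a ≢ c →
                               orderings increasing a b c ≡ 1ℤ
      orderings-increasing-< {a} {b} {c} a<b b≢c a≢c with Finₚ.<-cmp b c | Finₚ.<-cmp a c
      ... | tri< b<c _ _ | _            = orderings-increasing-sorted a<b b<c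
      ... | tri≈ _ b≡c _ | _            = contradiction b≡c b≢c
      ... | tri> _ _ c<b | tri< a<c _ _ = trans (orderings-swap₂₃ increasing a c b)
                                                (orderings-increasing-sorted a<c c<b)
      ... | tri> _ _ c<b | tri≈ _ a≡c _ = contradiction a≡c a≢c
      ... | tri> _ _ c<b | tri> _ _ c<a = trans (orderings-swap₂₃ increasing a c b)
                                         (trans (orderings-swap₁₂ increasing c a b)
                                                (orderings-increasing-sorted c<a a<b))

    orderings-increasing : ∀ {a b c : Fin n} → a ≢ b → b ≢ c → a ≢ c → orderings increasing a b c ≡ 1ℤ
    orderings-increasing {a} {b} {c} a≢b b≢c a≢c with Finₚ.<-cmp a b
    ... | tri< a<b _ _ = orderings-increasing-< a<b b≢c a≢c
    ... | tri≈ _ a≡b _ = contradiction a≡b a≢b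
    ... | tri> _ _ b<a = trans (orderings-swap₁₂ increasing b a c)
                               (orderings-increasing-< b<a a≢c b≢c)

  -- Counting co-cherries and triangles

  cherryWeight : Bool → Bool → ℤ
  cherryWeight x y = ⟦ x ⟧ * (1ℤ - + 2 * ⟦ y ⟧)

  cherryWeight-orderings : ∀ ab ba ac ca bc cb → ba ≡ ab → ca ≡ ac → cb ≡ bc →
    cherryWeight ab ac + cherryWeight ac ab + cherryWeight ba bc + cherryWeight bc ba
      + cherryWeight ca cb + cherryWeight cb ca + + 6 * ⟦ b2n ab ℕ.+ b2n ac ℕ.+ b2n bc ≡ᵇ 3 ⟧
    ≡ + 2 * ⟦ b2n ab ℕ.+ b2n ac ℕ.+ b2n bc ≡ᵇ 1 ⟧
  cherryWeight-orderings false _ false _ false _ refl refl refl = refl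
  cherryWeight-orderings false _ false _ true  _ refl refl refl = refl
  cherryWeight-orderings false _ true  _ false _ refl refl refl = refl
  cherryWeight-orderings false _ true  _ true  _ refl refl refl = refl
  cherryWeight-orderings true  _ false _ false _ refl refl refl = refl
  cherryWeight-orderings true  _ false _ true  _ refl refl refl = refl
  cherryWeight-orderings true  _ true  _ false _ refl refl refl = refl
  cherryWeight-orderings true  _ true  _ true  _ refl refl refl = refl

  module _ (G : Graph) where
    adjacent : Fin (size G) → Fin (size G) → ℤ
    adjacent a b = ⟦ adj G a b ⟧

    degree : Fin (size G) → ℤ
    degree a = sum (adjacent a)

    weight : Fin (size G) → Fin (size G) → Fin (size G) → ℤ
    weight a b c = cherryWeight (adj G a b) (adj G a c)

    induces : ℕ → Fin (size G) → Fin (size G) → Fin (size G) → ℤ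
    induces e a b c = ⟦ edgesAmong G a b c ≡ᵇ e ⟧

    ∑²-weight : ∀ a → ∑[ b < size G ] ∑[ c < size G ] weight a b c ≡ degree a * (+ size G - + 2 * degree a)
    ∑²-weight a = begin
        ∑[ b < size G ] ∑[ c < size G ] (adjacent a b * (1ℤ - + 2 * adjacent a c))
      ≡⟨ sum-cong-≗ (λ b → *-distribˡ-sum (adjacent a b) (λ c → 1ℤ - + 2 * adjacent a c)) ⟨
        ∑[ b < size G ] (adjacent a b * ∑[ c < size G ] (1ℤ - + 2 * adjacent a c))
      ≡⟨ *-distribʳ-sum (∑[ c < size G ] (1ℤ - + 2 * adjacent a c)) (adjacent a) ⟨
        degree a * ∑[ c < size G ] (1ℤ - + 2 * adjacent a c)
      ≡⟨ cong (degree a *_) (∑[1-2f]≡n-2∑f (adjacent a)) ⟩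
        degree a * (+ size G - + 2 * degree a)
      ∎
      where open ≡-Reasoning

    8∑³weight≤n³ : + 8 * ∑³ weight ≤ + size G * (+ size G * + size G)
    8∑³weight≤n³ = begin
        + 8 * ∑³ weight
      ≡⟨ cong (_*_ (+ 8)) (sum-cong-≗ ∑²-weight) ⟩
        + 8 * ∑[ a < size G ] (degree a * (+ size G - + 2 * degree a))
      ≡⟨ *-distribˡ-sum (+ 8) (λ a → degree a * (+ size G - + 2 * degree a)) ⟩
        ∑[ a < size G ] (+ 8 * (degree a * (+ size G - + 2 * degree a)))
      ≤⟨ ∑-mono-≤ (λ a → 8i[j-2i]≤j*j (degree a) (+ size G)) ⟩
        ∑[ a < size G ] (+ size G * + size G)
      ≡⟨ ∑-const (size G) _ ⟩
        + size G * (+ size G * + size G)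
      ∎
      where open ℤ.≤-Reasoning

    weight-orderings : ∀ a b c → orderings weight a b c + + 6 * induces 3 a b c ≡ + 2 * induces 1 a b c
    weight-orderings a b c = cherryWeight-orderings (adj G a b) (adj G b a) (adj G a c) (adj G c a)
      (adj G b c) (adj G c b) (adj-sym G b a) (adj-sym G c a) (adj-sym G c b)

    induces-symmetric : ∀ e → Symmetric₃ (induces e)
    induces-symmetric e = record
      { swap₁₂ = λ a b c → cong (λ m → ⟦ m ≡ᵇ e ⟧) (edges-swap₁₂ a b c)
      ; swap₂₃ = λ a b c → cong (λ m → ⟦ m ≡ᵇ e ⟧) (edges-swap₂₃ a b c)
      }
      where
      edges-swap₁₂ : ∀ a b c → edgesAmong G b a c ≡ edgesAmong G a b c
      edges-swap₁₂ a b c =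
        trans (cong (λ x → b2n x ℕ.+ b2n (adj G b c) ℕ.+ b2n (adj G a c)) (adj-sym G b a))
              (xy∙z≈xz∙y (b2n (adj G a b)) _ _)
      edges-swap₂₃ : ∀ a b c → edgesAmong G a c b ≡ edgesAmong G a b c
      edges-swap₂₃ a b c =
        trans (cong (λ x → b2n (adj G a c) ℕ.+ b2n (adj G a b) ℕ.+ b2n x) (adj-sym G c b))
              (xy∙z≈yx∙z (b2n (adj G a c)) _ _)

    inducedCount-∑³ : ∀ e → + inducedCount e G ≡ ∑³ (λ a b c → increasing a b c * induces e a b c)
    inducedCount-∑³ e = begin
        + inducedCount e G
      ≡⟨ +sumℕ-concatMap id (λ a → concatMap (λ b → map (triple a b) V) V) ⟩
        ∑[ a < size G ] (+ sumℕ (concatMap (λ b → map (triple a b) V) V))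
      ≡⟨ sum-cong-≗ (λ a → +sumℕ-concatMap id (λ b → map (triple a b) V)) ⟩
        ∑[ a < size G ] ∑[ b < size G ] (+ sumℕ (map (triple a b) V))
      ≡⟨ sum-cong-≗ (λ a → sum-cong-≗ λ b → +sumℕ-map id (triple a b)) ⟩
        ∑³ (λ a b c → + triple a b c)
      ≡⟨ ∑³-cong (λ a b c → ⟦∧∧⟧ (toℕ a <ᵇ toℕ b) (toℕ b <ᵇ toℕ c) (edgesAmong G a b c ≡ᵇ e)) ⟩
        ∑³ (λ a b c → increasing a b c * induces e a b c)
      ∎
      where
      open ≡-Reasoning
      V : List (Fin (size G))
      V = allFin (size G)
      triple : Fin (size G) → Fin (size G) → Fin (size G) → ℕ
      triple a b c = b2n ((toℕ a <ᵇ toℕ b) ∧ (toℕ b <ᵇ toℕ c) ∧ (edgesAmong G a b c ≡ᵇ e))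

    -- A triple with a repeated vertex spans 0 or 2 edges (the repeated pair counts twice).
    module _ {e : ℕ} (e≢0 : e ≢ 0) (e≢2 : e ≢ 2) where
      induces-diagonal : ∀ a c → induces e a a c ≡ 0ℤ
      induces-diagonal a c rewrite adj-irrefl G a with adj G a c
      ... | false = cong ⟦_⟧ (dec-false (0 ≟ e) (e≢0 ∘ sym))
      ... | true  = cong ⟦_⟧ (dec-false (2 ≟ e) (e≢2 ∘ sym))

      induces-degenerate : ∀ {a b c} → a ≡ b ⊎ b ≡ c ⊎ a ≡ c → induces e a b c ≡ 0ℤ
      induces-degenerate {a} {_} {c} (inj₁ refl)        = induces-diagonal a c
      induces-degenerate {a} {b} {_} (inj₂ (inj₁ refl)) = trans (rotate⁻¹ b b a) (induces-diagonal b a)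
        where open Symmetric₃ (induces-symmetric e)
      induces-degenerate {a} {b} {_} (inj₂ (inj₂ refl)) = trans (swap₂₃ a a b) (induces-diagonal a b)
        where open Symmetric₃ (induces-symmetric e)

      orderings-increasing-*-induces : ∀ a b c →
                                       orderings increasing a b c * induces e a b c ≡ induces e a b c
      orderings-increasing-*-induces a b c with a Fin.≟ b | b Fin.≟ c | a Fin.≟ c
      ... | yes a≡b | _       | _       =
        y≡0⇒x*y≡y (orderings increasing a b c) (induces-degenerate (inj₁ a≡b))
      ... | no _    | yes b≡c | _       =
        y≡0⇒x*y≡y (orderings increasing a b c) (induces-degenerate (inj₂ (inj₁ b≡c)))
      ... | no _    | no _    | yes a≡c =
        y≡0⇒x*y≡y (orderings increasing a b c) (induces-degenerate (inj₂ (inj₂ a≡c)))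
      ... | no a≢b  | no b≢c  | no a≢c  =
        trans (cong (_* induces e a b c) (orderings-increasing a≢b b≢c a≢c)) (ℤ.*-identityˡ _)

      ∑³-induces : ∑³ (induces e) ≡ + 6 * + inducedCount e G
      ∑³-induces = begin
          ∑³ (induces e)
        ≡⟨ ∑³-cong (λ a b c → trans (orderings-*ʳ increasing (induces e) (induces-symmetric e) a b c)
                                    (orderings-increasing-*-induces a b c)) ⟨
          ∑³ (orderings counted)
        ≡⟨ ∑³-orderings counted ⟩
          + 6 * ∑³ counted
        ≡⟨ cong (_*_ (+ 6)) (inducedCount-∑³ e) ⟨
          + 6 * + inducedCount e G
        ∎
        where
        open ≡-Reasoning
        counted : Fin (size G) → Fin (size G) → Fin (size G) → ℤ
        counted a b c = increasing a b c * induces e a b c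

    ∑³-weight : ∑³ weight + + 6 * + inducedCount 3 G ≡ + 2 * + inducedCount 1 G
    ∑³-weight = ℤ.*-cancelˡ-≡ (+ 6) _ _ (begin
        + 6 * (∑³ weight + + 6 * c₃)
      ≡⟨ ℤ.*-distribˡ-+ (+ 6) (∑³ weight) (+ 6 * c₃) ⟩
        + 6 * ∑³ weight + + 6 * (+ 6 * c₃)
      ≡⟨ cong₂ _+_ (∑³-orderings weight) (cong (_*_ (+ 6)) (∑³-induces (λ ()) (λ ()))) ⟨
        ∑³ (orderings weight) + + 6 * ∑³ (induces 3)
      ≡⟨ cong (_+_ (∑³ (orderings weight))) (*-distribˡ-∑³ (+ 6) (induces 3)) ⟩
        ∑³ (orderings weight) + ∑³ (λ a b c → + 6 * induces 3 a b c)
      ≡⟨ ∑³-distrib-+ (orderings weight) (λ a b c → + 6 * induces 3 a b c) ⟨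
        ∑³ (λ a b c → orderings weight a b c + + 6 * induces 3 a b c)
      ≡⟨ ∑³-cong weight-orderings ⟩
        ∑³ (λ a b c → + 2 * induces 1 a b c)
      ≡⟨ *-distribˡ-∑³ (+ 2) (induces 1) ⟨
        + 2 * ∑³ (induces 1)
      ≡⟨ cong (_*_ (+ 2)) (∑³-induces (λ ()) (λ ())) ⟩
        + 2 * (+ 6 * c₁)
      ≡⟨ x∙yz≈y∙xz (+ 2) (+ 6) c₁ ⟩
        + 6 * (+ 2 * c₁)
      ∎)
      where
      open ≡-Reasoning
      c₁ c₃ : ℤ
      c₁ = + inducedCount 1 G
      c₃ = + inducedCount 3 G

    co-cherry-bound : 16 ℕ.* inducedCount 1 G ℕ.≤ size G ℕ.* (size G ℕ.* size G) ℕ.+ 48 ℕ.* inducedCount 3 G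
    co-cherry-bound = ℤ.drop‿+≤+ (begin
        + (16 ℕ.* c₁)
      ≡⟨ ℤ.pos-* 16 c₁ ⟩
        + 8 * + 2 * + c₁
      ≡⟨ trans (ℤ.*-assoc (+ 8) (+ 2) (+ c₁)) (cong (_*_ (+ 8)) (sym ∑³-weight)) ⟩
        + 8 * (∑³ weight + + 6 * + c₃)
      ≡⟨ expand (∑³ weight) (+ c₃) ⟩
        + 8 * ∑³ weight + + 48 * + c₃
      ≤⟨ ℤ.+-monoˡ-≤ (+ 48 * + c₃) 8∑³weight≤n³ ⟩
        + n * (+ n * + n) + + 48 * + c₃
      ≡⟨ cong₂ _+_ (trans (ℤ.pos-* n (n ℕ.* n)) (cong (_*_ (+ n)) (ℤ.pos-* n n))) (ℤ.pos-* 48 c₃) ⟨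
        + (n ℕ.* (n ℕ.* n) ℕ.+ 48 ℕ.* c₃)
      ∎)
      where
      open ℤ.≤-Reasoning
      n c₁ c₃ : ℕ
      n  = size G
      c₁ = inducedCount 1 G
      c₃ = inducedCount 3 G
      expand : ∀ w c → + 8 * (w + + 6 * c) ≡ + 8 * w + + 48 * c
      expand = solve-∀

-- Estimates for C(n,3)

module _ where
  open import Data.Nat using (_+_; _*_; _≤_; _<_)
  open import Data.Nat.Combinatorics using (_C_; nCk+nC[k+1]≡[n+1]C[k+1]; nC1≡n)
  open import Data.Nat.Tactic.RingSolver using (solve-∀; solve)
  open import Algebra.Properties.CommutativeSemigroup ℕₚ.*-commutativeSemigroup using (x∙yz≈y∙xz)

  2*[1+n]C2≡[1+n]*n : ∀ n → 2 * (suc n C 2) ≡ suc n * n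
  2*[1+n]C2≡[1+n]*n zero    = refl
  2*[1+n]C2≡[1+n]*n (suc n) = begin
      2 * (suc (suc n) C 2)
    ≡⟨ cong (2 *_) (nCk+nC[k+1]≡[n+1]C[k+1] (suc n) 1) ⟨
      2 * (suc n C 1 + suc n C 2)
    ≡⟨ cong (λ x → 2 * (x + suc n C 2)) (nC1≡n (suc n)) ⟩
      2 * (suc n + suc n C 2)
    ≡⟨ ℕₚ.*-distribˡ-+ 2 (suc n) (suc n C 2) ⟩
      2 * suc n + 2 * (suc n C 2)
    ≡⟨ cong (2 * suc n +_) (2*[1+n]C2≡[1+n]*n n) ⟩
      2 * suc n + suc n * n
    ≡⟨ solve (n ∷ []) ⟩
      suc (suc n) * suc n
    ∎
    where open ≡-Reasoning

  6*[2+n]C3≡[2+n]*[1+n]*n : ∀ n → 6 * ((2 + n) C 3) ≡ (2 + n) * (1 + n) * n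
  6*[2+n]C3≡[2+n]*[1+n]*n zero    = refl
  6*[2+n]C3≡[2+n]*[1+n]*n (suc n) = begin
      6 * ((3 + n) C 3)
    ≡⟨ cong (6 *_) (nCk+nC[k+1]≡[n+1]C[k+1] (2 + n) 2) ⟨
      6 * ((2 + n) C 2 + (2 + n) C 3)
    ≡⟨ ℕₚ.*-distribˡ-+ 6 ((2 + n) C 2) ((2 + n) C 3) ⟩
      6 * ((2 + n) C 2) + 6 * ((2 + n) C 3)
    ≡⟨ cong₂ _+_ (trans (ℕₚ.*-assoc 3 2 ((2 + n) C 2)) (cong (3 *_) (2*[1+n]C2≡[1+n]*n (suc n))))
                 (6*[2+n]C3≡[2+n]*[1+n]*n n) ⟩
      3 * ((2 + n) * (1 + n)) + (2 + n) * (1 + n) * n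
    ≡⟨ solve (n ∷ []) ⟩
      (3 + n) * (2 + n) * (1 + n)
    ∎
    where open ≡-Reasoning

  0<[3+n]C3 : ∀ n → 0 < (3 + n) C 3
  0<[3+n]C3 n = ℕₚ.n≢0⇒n>0 λ C≡0 →
    ℕₚ.0≢1+n (trans (cong (6 *_) (sym C≡0)) (6*[2+n]C3≡[2+n]*[1+n]*n (suc n)))

  cube≤binomial : ∀ k s → 3 * k ≤ s → k * ((2 + s) * ((2 + s) * (2 + s))) ≤ (6 * k + 16) * ((2 + s) C 3)
  cube≤binomial k s 3k≤s with ℕₚ.m≤n⇒∃[o]m+o≡n 3k≤s
  ... | t , refl = ℕₚ.*-cancelˡ-≤ 6 (begin
      6 * (k * (n * (n * n)))
    ≤⟨ ℕₚ.m≤m+n _ _ ⟩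
      6 * (k * (n * (n * n))) + n * (90 * k * k + 78 * k * t + 16 * t * t + 24 * k + 16 * t)
    ≡⟨ expand k t ⟩
      (6 * k + 16) * (n * (1 + (3 * k + t)) * (3 * k + t))
    ≡⟨ cong ((6 * k + 16) *_) (6*[2+n]C3≡[2+n]*[1+n]*n (3 * k + t)) ⟨
      (6 * k + 16) * (6 * (n C 3))
    ≡⟨ x∙yz≈y∙xz (6 * k + 16) 6 (n C 3) ⟩
      6 * ((6 * k + 16) * (n C 3))
    ∎)
    where
    open ℕₚ.≤-Reasoning
    n : ℕ
    n = 2 + (3 * k + t)
    expand : ∀ k t →
      6 * (k * ((2 + (3 * k + t)) * ((2 + (3 * k + t)) * (2 + (3 * k + t)))))
        + (2 + (3 * k + t)) * (90 * k * k + 78 * k * t + 16 * t * t + 24 * k + 16 * t)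
      ≡ (6 * k + 16) * ((2 + (3 * k + t)) * (1 + (3 * k + t)) * (3 * k + t))
    expand = solve-∀

  counts-bound : ∀ k s c₁ c₃ → 3 * k ≤ s →
                 16 * c₁ ≤ (2 + s) * ((2 + s) * (2 + s)) + 48 * c₃ →
                 8 * k * c₁ ≤ 24 * k * c₃ + 3 * k * ((2 + s) C 3) + 8 * ((2 + s) C 3)
  counts-bound k s c₁ c₃ 3k≤s co-cherry = ℕₚ.*-cancelˡ-≤ 2 (begin
      2 * (8 * k * c₁)
    ≡⟨ solve (k ∷ c₁ ∷ []) ⟩
      k * (16 * c₁)
    ≤⟨ ℕₚ.*-monoʳ-≤ k co-cherry ⟩
      k * (n * (n * n) + 48 * c₃)
    ≡⟨ ℕₚ.*-distribˡ-+ k (n * (n * n)) (48 * c₃) ⟩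
      k * (n * (n * n)) + k * (48 * c₃)
    ≤⟨ ℕₚ.+-monoˡ-≤ (k * (48 * c₃)) (cube≤binomial k s 3k≤s) ⟩
      (6 * k + 16) * (n C 3) + k * (48 * c₃)
    ≡⟨ regroup k c₃ (n C 3) ⟩
      2 * (24 * k * c₃ + 3 * k * (n C 3) + 8 * (n C 3))
    ∎)
    where
    open ℕₚ.≤-Reasoning
    n : ℕ
    n = 2 + s
    regroup : ∀ k c x → (6 * k + 16) * x + k * (48 * c) ≡ 2 * (24 * k * c + 3 * k * x + 8 * x)
    regroup = solve-∀

-- From counts to densities

module _ where
  open import Data.Integer as ℤ using (+_; +[1+_]; -[1+_]; +≤+)
  import Data.Integer.Properties as ℤₚ
  open import Data.Rational using (ℚ; mkℚ; 0ℚ; _/_; _+_; _*_; _≤_; _<_; toℚᵘ; *<*)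
  import Data.Rational.Properties as ℚₚ
  open import Data.Rational.Unnormalised as ℚᵘ using (ℚᵘ; mkℚᵘ; *≤*; ↥_; ↧_)
  import Data.Rational.Unnormalised.Properties as ℚᵘₚ
  open import Data.Nat.Combinatorics using (_C_)
  open import Data.Nat.Tactic.RingSolver using (solve-∀)

  toℚᵘ-/ : ∀ c m → toℚᵘ ((+ c) / suc m) ℚᵘ.≃ mkℚᵘ (+ c) m
  toℚᵘ-/ c m = ℚₚ.toℚᵘ-fromℚᵘ (mkℚᵘ (+ c) m)

  ratio-bound : ∀ c₁ c₃ D k → 0 ℕ.< D →
    8 ℕ.* suc k ℕ.* c₁ ℕ.≤ 24 ℕ.* suc k ℕ.* c₃ ℕ.+ 3 ℕ.* suc k ℕ.* D ℕ.+ 8 ℕ.* D →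
    ratio c₁ D ≤ ((+ 3) / 1) * ratio c₃ D + (+ 3) / 8 + (+ 1) / suc k
  ratio-bound c₁ c₃ (suc m) k _ h = ℚₚ.toℚᵘ-cancel-≤
      (ℚᵘₚ.≤-respˡ-≃ (ℚᵘₚ.≃-sym (toℚᵘ-/ c₁ m)) (ℚᵘₚ.≤-respʳ-≃ (ℚᵘₚ.≃-sym toℚᵘ-rhs) (*≤* cleared)))
    where
    M K : ℕ
    M = suc m
    K = suc k

    R : ℚᵘ
    R = mkℚᵘ (+ 3) 0 ℚᵘ.* mkℚᵘ (+ c₃) m ℚᵘ.+ mkℚᵘ (+ 3) 7 ℚᵘ.+ mkℚᵘ (+ 1) k

    toℚᵘ-rhs : toℚᵘ (((+ 3) / 1) * ((+ c₃) / M) + (+ 3) / 8 + (+ 1) / K) ℚᵘ.≃ R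
    toℚᵘ-rhs = ℚᵘₚ.≃-trans (ℚₚ.toℚᵘ-homo-+ (x * y + z) w) (ℚᵘₚ.+-cong
      (ℚᵘₚ.≃-trans (ℚₚ.toℚᵘ-homo-+ (x * y) z) (ℚᵘₚ.+-cong
        (ℚᵘₚ.≃-trans (ℚₚ.toℚᵘ-homo-* x y) (ℚᵘₚ.*-cong (toℚᵘ-/ 3 0) (toℚᵘ-/ c₃ m)))
        (toℚᵘ-/ 3 7)))
      (toℚᵘ-/ 1 k))
      where
      x y z w : ℚ
      x = (+ 3) / 1
      y = (+ c₃) / M
      z = (+ 3) / 8
      w = (+ 1) / K

    -- ↧ R reduces to + (1 * M * 8 * K); ↥ R is + Y up to the placement of the casts.
    Y : ℕ
    Y = (3 ℕ.* c₃ ℕ.* 8 ℕ.+ 3 ℕ.* (1 ℕ.* M)) ℕ.* K ℕ.+ 1 ℕ.* (1 ℕ.* M ℕ.* 8)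

    ↥R≡+Y : ↥ R ≡ + Y
    ↥R≡+Y = begin
        ((+ 3 ℤ.* + c₃) ℤ.* + 8 ℤ.+ + (3 ℕ.* (1 ℕ.* M))) ℤ.* + K ℤ.+ + (1 ℕ.* (1 ℕ.* M ℕ.* 8))
      ≡⟨ cong (λ x → (x ℤ.* + 8 ℤ.+ + (3 ℕ.* (1 ℕ.* M))) ℤ.* + K ℤ.+ + (1 ℕ.* (1 ℕ.* M ℕ.* 8)))
              (ℤₚ.pos-* 3 c₃) ⟨
        (+ (3 ℕ.* c₃) ℤ.* + 8 ℤ.+ + (3 ℕ.* (1 ℕ.* M))) ℤ.* + K ℤ.+ + (1 ℕ.* (1 ℕ.* M ℕ.* 8))
      ≡⟨ cong (λ x → (x ℤ.+ + (3 ℕ.* (1 ℕ.* M))) ℤ.* + K ℤ.+ + (1 ℕ.* (1 ℕ.* M ℕ.* 8)))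
              (ℤₚ.pos-* (3 ℕ.* c₃) 8) ⟨
        + (3 ℕ.* c₃ ℕ.* 8 ℕ.+ 3 ℕ.* (1 ℕ.* M)) ℤ.* + K ℤ.+ + (1 ℕ.* (1 ℕ.* M ℕ.* 8))
      ≡⟨ cong (ℤ._+ + (1 ℕ.* (1 ℕ.* M ℕ.* 8))) (ℤₚ.pos-* (3 ℕ.* c₃ ℕ.* 8 ℕ.+ 3 ℕ.* (1 ℕ.* M)) K) ⟨
        + Y
      ∎
      where open ≡-Reasoning

    cleared-ℕ : c₁ ℕ.* (1 ℕ.* M ℕ.* 8 ℕ.* K) ℕ.≤ Y ℕ.* M
    cleared-ℕ = begin
        c₁ ℕ.* (1 ℕ.* M ℕ.* 8 ℕ.* K)
      ≡⟨ e₁ c₁ M K ⟩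
        8 ℕ.* K ℕ.* c₁ ℕ.* M
      ≤⟨ ℕₚ.*-monoˡ-≤ M h ⟩
        (24 ℕ.* K ℕ.* c₃ ℕ.+ 3 ℕ.* K ℕ.* M ℕ.+ 8 ℕ.* M) ℕ.* M
      ≡⟨ e₂ c₃ M K ⟩
        Y ℕ.* M
      ∎
      where
      open ℕₚ.≤-Reasoning
      e₁ : ∀ c M K → c ℕ.* (1 ℕ.* M ℕ.* 8 ℕ.* K) ≡ 8 ℕ.* K ℕ.* c ℕ.* M
      e₁ = solve-∀
      e₂ : ∀ c M K → (24 ℕ.* K ℕ.* c ℕ.+ 3 ℕ.* K ℕ.* M ℕ.+ 8 ℕ.* M) ℕ.* M
                     ≡ ((3 ℕ.* c ℕ.* 8 ℕ.+ 3 ℕ.* (1 ℕ.* M)) ℕ.* K ℕ.+ 1 ℕ.* (1 ℕ.* M ℕ.* 8)) ℕ.* M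
      e₂ = solve-∀

    cleared : + c₁ ℤ.* ↧ R ℤ.≤ ↥ R ℤ.* + M
    cleared = begin
        + c₁ ℤ.* ↧ R                     ≡⟨ ℤₚ.pos-* c₁ (1 ℕ.* M ℕ.* 8 ℕ.* K) ⟨
        + (c₁ ℕ.* (1 ℕ.* M ℕ.* 8 ℕ.* K)) ≤⟨ +≤+ cleared-ℕ ⟩
        + (Y ℕ.* M)                      ≡⟨ ℤₚ.pos-* Y M ⟩
        + Y ℤ.* + M                      ≡⟨ cong (ℤ._* + M) ↥R≡+Y ⟨
        ↥ R ℤ.* + M                      ∎
      where open ℤₚ.≤-Reasoning

  0<ε⇒∃1/[1+k]≤ε : ∀ ε → 0ℚ < ε → ∃ λ k → (+ 1) / suc k ≤ ε
  0<ε⇒∃1/[1+k]≤ε (mkℚ (+ zero) k _) (*<* (ℤ.+<+ ()))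
  0<ε⇒∃1/[1+k]≤ε (mkℚ -[1+ j ] k _) (*<* ())
  0<ε⇒∃1/[1+k]≤ε (mkℚ +[1+ j ] k _) _ = k , ℚₚ.toℚᵘ-cancel-≤
    (ℚᵘₚ.≤-respˡ-≃ (ℚᵘₚ.≃-sym (toℚᵘ-/ 1 k))
                   (*≤* (ℤₚ.*-monoʳ-≤-nonNeg (+ suc k) {+ 1} {+[1+ j ]} (+≤+ (ℕ.s≤s ℕ.z≤n)))))

  density-bound : ∀ G k → 2 ℕ.+ 3 ℕ.* suc k ℕ.≤ size G →
                  d 1 G ≤ ((+ 3) / 1) * d 3 G + (+ 3) / 8 + (+ 1) / suc k
  density-bound G k large =
    counts-ratio-bound (inducedCount 1 G) (inducedCount 3 G) large (co-cherry-bound G)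
    where
    counts-ratio-bound : ∀ {n} c₁ c₃ → 2 ℕ.+ 3 ℕ.* suc k ℕ.≤ n →
                         16 ℕ.* c₁ ℕ.≤ n ℕ.* (n ℕ.* n) ℕ.+ 48 ℕ.* c₃ →
                         ratio c₁ (n C 3) ≤ ((+ 3) / 1) * ratio c₃ (n C 3) + (+ 3) / 8 + (+ 1) / suc k
    counts-ratio-bound c₁ c₃ (ℕ.s≤s (ℕ.s≤s 3[1+k]≤s@(ℕ.s≤s {n = s} _))) co-cherry =
      ratio-bound c₁ c₃ _ k (0<[3+n]C3 s) (counts-bound (suc k) (suc s) c₁ c₃ 3[1+k]≤s co-cherry)

open import Data.Integer using (+_)
open import Data.Rational using (_/_; _*_; _+_)
import Data.Rational.Properties as ℚₚ

lemma6 : (Gs : ℕ → Graph) → SizeToInfinity Gs →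
         Converges (λ m → d 0 (Gs m)) → Converges (λ m → d 1 (Gs m)) →
         Converges (λ m → d 2 (Gs m)) → Converges (λ m → d 3 (Gs m)) →
         LimLe (λ m → d 1 (Gs m)) (λ m → ((+ 3) / 1) * d 3 (Gs m)) ((+ 3) / 8)
lemma6 Gs size→∞ _ _ _ _ ε ε>0 with 0<ε⇒∃1/[1+k]≤ε ε ε>0
... | k , 1/[1+k]≤ε with size→∞ (2 ℕ.+ 3 ℕ.* suc k)
... | M , large = M , λ m M≤m →
  ℚₚ.≤-trans (density-bound (Gs m) k (large m M≤m))
             (ℚₚ.+-monoʳ-≤ (((+ 3) / 1) * d 3 (Gs m) + (+ 3) / 8) 1/[1+k]≤ε)
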